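{- Let $t,u$ be vsub-terms. (1) If $t\to_{\mathtt m}u$ then $\overline{t}\to_{\mathtt m}\to_{\mathtt e_{\mathtt{var}}}r\equiv\overline{u}$ for some vsub-term $r$. (2) If $t\to_{\mathtt e_\lambda}u$ then $\overline{t}\to_{\mathtt e_\lambda}\overline{u}$, and if $t\to_{\mathtt e_{\mathtt{var}}}u$ then $\overline{t}\to_{\mathtt e_{\mathtt{var}}}\overline{u}$. (3) If $t\equiv u$ then $\overline{t}\equiv\overline{u}$.
   Context: Value substitution calculus: vsub-terms $t,u,s::= v\mid tu\mid t[x\leftarrow u]$, vsub-values $v::=x\mid\lambda x.t$; $t[x\leftarrow u]$ binds $x$ in $t$; up to $\alpha$; $t\{x\leftarrow u\}$ capture-avoiding substitution. Evaluation contexts $E::=\langle\cdot\rangle\mid tE\mid Et\mid E[x\leftarrow u]\mid t[x\leftarrow E]$; substitution contexts $L::=\langle\cdot\rangle\mid L[x\leftarrow u]$. $\to_{\mathtt m},\to_{\mathtt e_\lambda},\to_{\mathtt e_{\mathtt{var}}}$ are the closures under evaluation contexts of $L\langle\lambda x.t\rangle u\mapsto L\langle t[x\leftarrow u]\rangle$, $t[x\leftarrow L\langle \lambda y.u\rangle]\mapsto L\langle t\{x\leftarrow\lambda y.u\}\rangle$, and $t[x\leftarrow L\langle y\rangle]\mapsto L\langle t\{x\leftarrow y\}\rangle$ respectively (variables bound by $L$ not free in $u$, resp. $t$). Structural equivalence $\equiv$: least equivalence on vsub-terms closed under evaluation contexts containing $t[y\leftarrow s][x\leftarrow u]\equiv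 t[x\leftarrow u][y\leftarrow s]$ ($y\notin\mathrm{fv}(u)$, $x\notin\mathrm{fv}(s)$); $t\,(s[x\leftarrow u])\equiv (ts)[x\leftarrow u]$ ($x\notin\mathrm{fv}(t)$); $t[x\leftarrow u]\,s\equiv (ts)[x\leftarrow u]$ ($x\notin\mathrm{fv}(s)$); $t[x\leftarrow u[y\leftarrow s]]\equiv t[x\leftarrow u][y\leftarrow s]$ ($y\notin\mathrm{fv}(t)$). Translation: $\overline{x}=x$; $\overline{tu}=(\overline{t}\,x)[x\leftarrow\overline{u}]$ with $x$ fresh; $\overline{\lambda x.t}=\lambda x.\overline{t}$; $\overline{t[x\leftarrow u]}=\overline{t}[x\leftarrow\overline{u}]$. -}

module Defs where

open import Data.Nat using (ℕ; zero; suc)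
open import Data.Fin using (Fin; zero; suc)

-- Intrinsically scoped de Bruijn vsub-terms (α-equivalence is built in).
-- es t u  represents  t[x←u]  where x is variable 0 of t.
data Tm (n : ℕ) : Set where
  var : Fin n → Tm n
  lam : Tm (suc n) → Tm n
  app : Tm n → Tm n → Tm n
  es  : Tm (suc n) → Tm n → Tm n

Ren : ℕ → ℕ → Set
Ren n m = Fin n → Fin m

liftR : ∀ {n m} → Ren n m → Ren (suc n) (suc m)
liftR ρ zero = zero
liftR ρ (suc i) = suc (ρ i)

ren : ∀ {n m} → Ren n m → Tm n → Tm m
ren ρ (var i) = var (ρ i)
ren ρ (lam t) = lam (ren (liftR ρ) t)
ren ρ (app t u) = app (ren ρ t) (ren ρ u)
ren ρ (es t u) = es (ren (liftR ρ) t) (ren ρ u)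

wk : ∀ {n} → Tm n → Tm (suc n)
wk = ren suc

Sub : ℕ → ℕ → Set
Sub n m = Fin n → Tm m

liftS : ∀ {n m} → Sub n m → Sub (suc n) (suc m)
liftS σ zero = var zero
liftS σ (suc i) = wk (σ i)

sub : ∀ {n m} → Sub n m → Tm n → Tm m
sub σ (var i) = σ i
sub σ (lam t) = lam (sub (liftS σ) t)
sub σ (app t u) = app (sub σ t) (sub σ u)
sub σ (es t u) = es (sub (liftS σ) t) (sub σ u)

single : ∀ {n} → Tm n → Sub (suc n) n
single v zero = v
single v (suc i) = var i

_[0≔_] : ∀ {n} → Tm (suc n) → Tm n → Tm n
t [0≔ v ] = sub (single v) t

-- Substitution contexts L ::= ⟨·⟩ | L[x←u].
-- SCtx n m : plugging a term in scope m yields a term in scope n.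
data SCtx (n : ℕ) : ℕ → Set where
  hole : SCtx n n
  ext  : ∀ {m} → SCtx (suc n) m → Tm n → SCtx n m

plugL : ∀ {n m} → SCtx n m → Tm m → Tm n
plugL hole t = t
plugL (ext L u) t = es (plugL L t) u

-- the renaming moving a term from the outside of L into its hole
-- (i.e. the variables bound by L do not occur in it)
wkL : ∀ {n m} → SCtx n m → Ren n m
wkL hole i = i
wkL (ext L u) i = wkL L (suc i)

Rel : Set₁
Rel = ∀ {n} → Tm n → Tm n → Set

data RootM : Rel where
  rm : ∀ {n m} (L : SCtx n m) (t : Tm (suc m)) (u : Tm n) →
       RootM (app (plugL L (lam t)) u) (plugL L (es t (ren (wkL L) u)))

data RootEλ : Rel where
  reλ : ∀ {n m} (t : Tm (suc n)) (L : SCtx n m) (u : Tm (suc m)) →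
        RootEλ (es t (plugL L (lam u)))
               (plugL L ((ren (liftR (wkL L)) t) [0≔ lam u ]))

data RootEvar : Rel where
  revar : ∀ {n m} (t : Tm (suc n)) (L : SCtx n m) (y : Fin m) →
          RootEvar (es t (plugL L (var y)))
                   (plugL L ((ren (liftR (wkL L)) t) [0≔ var y ]))

data Ctx (R : Rel) : Rel where
  root : ∀ {n} {t u : Tm n} → R t u → Ctx R t u
  appR : ∀ {n} (t : Tm n) {u u' : Tm n} → Ctx R u u' → Ctx R (app t u) (app t u')
  appL : ∀ {n} {t t' : Tm n} (u : Tm n) → Ctx R t t' → Ctx R (app t u) (app t' u)
  esL  : ∀ {n} {t t' : Tm (suc n)} (u : Tm n) → Ctx R t t' → Ctx R (es t u) (es t' u)
  esR  : ∀ {n} (t : Tm (suc n)) {u u' : Tm n} → Ctx R u u' → Ctx R (es t u) (es t u')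

_→m_ : Rel
_→m_ = Ctx RootM

_→eλ_ : Rel
_→eλ_ = Ctx RootEλ

_→evar_ : Rel
_→evar_ = Ctx RootEvar

swap01 : ∀ {n} → Ren (suc (suc n)) (suc (suc n))
swap01 zero = suc zero
swap01 (suc zero) = zero
swap01 (suc (suc i)) = suc (suc i)

data _≡s_ : Rel where
  ≡refl  : ∀ {n} {t : Tm n} → t ≡s t
  ≡sym   : ∀ {n} {t u : Tm n} → t ≡s u → u ≡s t
  ≡trans : ∀ {n} {t u s : Tm n} → t ≡s u → u ≡s s → t ≡s s
  ≡appR  : ∀ {n} (t : Tm n) {u u' : Tm n} → u ≡s u' → app t u ≡s app t u'
  ≡appL  : ∀ {n} {t t' : Tm n} (u : Tm n) → t ≡s t' → app t u ≡s app t' u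
  ≡esL   : ∀ {n} {t t' : Tm (suc n)} (u : Tm n) → t ≡s t' → es t u ≡s es t' u
  ≡esR   : ∀ {n} (t : Tm (suc n)) {u u' : Tm n} → u ≡s u' → es t u ≡s es t u'
  -- t[y←s][x←u] ≡ t[x←u][y←s]   (y ∉ fv(u), x ∉ fv(s))
  ≡com   : ∀ {n} (t : Tm (suc (suc n))) (s u : Tm n) →
           es (es t (wk s)) u ≡s es (es (ren swap01 t) (wk u)) s
  -- t (s[x←u]) ≡ (t s)[x←u]   (x ∉ fv(t))
  ≡dup   : ∀ {n} (t : Tm n) (s : Tm (suc n)) (u : Tm n) →
           app t (es s u) ≡s es (app (wk t) s) u
  -- t[x←u] s ≡ (t s)[x←u]   (x ∉ fv(s))
  ≡appES    : ∀ {n} (t : Tm (suc n)) (u s : Tm n) →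
           app (es t u) s ≡s es (app t (wk s)) u
  -- t[x←u[y←s]] ≡ t[x←u][y←s]   (y ∉ fv(t))
  ≡esES   : ∀ {n} (t : Tm (suc n)) (u : Tm (suc n)) (s : Tm n) →
           es t (es u s) ≡s es (es (ren (liftR suc) t) u) s

-- translation: overline(t u) = (overline(t) x)[x←overline(u)], x fresh
tr : ∀ {n} → Tm n → Tm n
tr (var i) = var i
tr (lam t) = lam (tr t)
tr (app t u) = es (app (wk (tr t)) (var zero)) (tr u)
tr (es t u) = es (tr t) (tr u)

-- The translation commutes with renaming, substitution and plugging into
-- substitution contexts, so exponential steps are translated step for step
-- and the axioms of ≡ become (combinations of) axioms of ≡.  A multiplicative
-- step  L⟨λx.t⟩u → L⟨t[x←u]⟩  becomes  (L⟨λx.t⟩ z)[z←u], which fires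
-- (L⟨t[x←z]⟩)[z←u]; the variable-exchange step yields (L⟨t{x←z}⟩)[z←u], and
-- commuting [z←u] inwards past every substitution of L gives L⟨t[x←u]⟩.
module Submission where

open import Defs
open import Data.Nat using (ℕ; zero; suc)
open import Data.Fin using (Fin; zero; suc)
open import Data.Product using (Σ; _×_; _,_)
open import Data.Vec.Functional using (_∷_)
open import Function using (_∘_; id)
open import Relation.Binary.Bundles using (Setoid)
open import Relation.Binary.PropositionalEquality
import Relation.Binary.Reasoning.Setoid as SetoidReasoning

private variable
  n m k k′ : ℕ
  R : Rel
  t u : Tm n

liftR-∘ : {σ : Ren m k} {ρ : Ren n m} {τ : Ren n k} →
          σ ∘ ρ ≗ τ → liftR σ ∘ liftR ρ ≗ liftR τ
liftR-∘ h zero = refl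
liftR-∘ h (suc i) = cong suc (h i)

liftR-id : {ρ : Ren n n} → ρ ≗ id → liftR ρ ≗ id
liftR-id h zero = refl
liftR-id h (suc i) = cong suc (h i)

ren-∘ : {σ : Ren m k} {ρ : Ren n m} {τ : Ren n k} →
        σ ∘ ρ ≗ τ → ren σ ∘ ren ρ ≗ ren τ
ren-∘ h (var i) = cong var (h i)
ren-∘ h (lam t) = cong lam (ren-∘ (liftR-∘ h) t)
ren-∘ h (app t u) = cong₂ app (ren-∘ h t) (ren-∘ h u)
ren-∘ h (es t u) = cong₂ es (ren-∘ (liftR-∘ h) t) (ren-∘ h u)

ren-id : {ρ : Ren n n} → ρ ≗ id → ren ρ ≗ id
ren-id h (var i) = cong var (h i)
ren-id h (lam t) = cong lam (ren-id (liftR-id h) t)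
ren-id h (app t u) = cong₂ app (ren-id h t) (ren-id h u)
ren-id h (es t u) = cong₂ es (ren-id (liftR-id h) t) (ren-id h u)

ren-ext : {ρ σ : Ren n m} → ρ ≗ σ → ren ρ ≗ ren σ
ren-ext {ρ = ρ} h t = trans (cong (ren ρ) (sym (ren-id (λ _ → refl) t))) (ren-∘ h t)

ren-comm : {σ : Ren m k} {ρ : Ren n m} {ρ′ : Ren k′ k} {σ′ : Ren n k′} →
           σ ∘ ρ ≗ ρ′ ∘ σ′ → ren σ ∘ ren ρ ≗ ren ρ′ ∘ ren σ′
ren-comm h t = trans (ren-∘ (λ _ → refl) t) (sym (ren-∘ (sym ∘ h) t))

wk-ren : (ρ : Ren n m) → wk ∘ ren ρ ≗ ren (liftR ρ) ∘ wk
wk-ren ρ = ren-comm (λ _ → refl)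

swap01-liftR-suc : swap01 ∘ liftR suc ≗ suc {suc n}
swap01-liftR-suc zero = refl
swap01-liftR-suc (suc i) = refl

liftS-liftR : {σ : Sub m k} {ρ : Ren n m} {τ : Sub n k} →
              σ ∘ ρ ≗ τ → liftS σ ∘ liftR ρ ≗ liftS τ
liftS-liftR h zero = refl
liftS-liftR h (suc i) = cong wk (h i)

sub-ren : {σ : Sub m k} {ρ : Ren n m} {τ : Sub n k} →
          σ ∘ ρ ≗ τ → sub σ ∘ ren ρ ≗ sub τ
sub-ren h (var i) = h i
sub-ren h (lam t) = cong lam (sub-ren (liftS-liftR h) t)
sub-ren h (app t u) = cong₂ app (sub-ren h t) (sub-ren h u)
sub-ren h (es t u) = cong₂ es (sub-ren (liftS-liftR h) t) (sub-ren h u)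

liftR-liftS : {ρ : Ren m k} {σ : Sub n m} {τ : Sub n k} →
              ren ρ ∘ σ ≗ τ → ren (liftR ρ) ∘ liftS σ ≗ liftS τ
liftR-liftS h zero = refl
liftR-liftS {ρ = ρ} {σ} h (suc i) = trans (sym (wk-ren ρ (σ i))) (cong wk (h i))

ren-sub : {ρ : Ren m k} {σ : Sub n m} {τ : Sub n k} →
          ren ρ ∘ σ ≗ τ → ren ρ ∘ sub σ ≗ sub τ
ren-sub h (var i) = h i
ren-sub h (lam t) = cong lam (ren-sub (liftR-liftS h) t)
ren-sub h (app t u) = cong₂ app (ren-sub h t) (ren-sub h u)
ren-sub h (es t u) = cong₂ es (ren-sub (liftR-liftS h) t) (ren-sub h u)

wk-sub : (σ : Sub n m) → wk ∘ sub σ ≗ sub (liftS σ) ∘ wk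
wk-sub σ t = trans (ren-sub (λ _ → refl) t) (sym (sub-ren (λ _ → refl) t))

var-liftR : {ρ : Ren n m} {σ : Sub n m} → var ∘ ρ ≗ σ → var ∘ liftR ρ ≗ liftS σ
var-liftR h zero = refl
var-liftR h (suc i) = cong wk (h i)

ren-as-sub : {ρ : Ren n m} {σ : Sub n m} → var ∘ ρ ≗ σ → ren ρ ≗ sub σ
ren-as-sub h (var i) = h i
ren-as-sub h (lam t) = cong lam (ren-as-sub (var-liftR h) t)
ren-as-sub h (app t u) = cong₂ app (ren-as-sub h t) (ren-as-sub h u)
ren-as-sub h (es t u) = cong₂ es (ren-as-sub (var-liftR h) t) (ren-as-sub h u)

[0≔var]-ren : (ρ : Ren n m) (y : Fin m) (t : Tm (suc n)) →
              ren (liftR ρ) t [0≔ var y ] ≡ ren (y ∷ ρ) t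
[0≔var]-ren ρ y t = trans (sub-ren pw t) (sym (ren-as-sub (λ _ → refl) t))
  where
  pw : single (var y) ∘ liftR ρ ≗ var ∘ (y ∷ ρ)
  pw zero = refl
  pw (suc i) = refl

-- Renaming the outside of a substitution context.  The scope inside L changes
-- with its outer scope, and ρ continues under the binders of L as renHole ρ L.

rescope : SCtx n m → ℕ → ℕ
rescope hole k = k
rescope (ext L u) k = rescope L (suc k)

renL : Ren n k → (L : SCtx n m) → SCtx k (rescope L k)
renL ρ hole = hole
renL ρ (ext L u) = ext (renL (liftR ρ) L) (ren ρ u)

renHole : Ren n k → (L : SCtx n m) → Ren m (rescope L k)
renHole ρ hole = ρ
renHole ρ (ext L u) = renHole (liftR ρ) L

rescopeRen : (L : SCtx n m) → Ren k k′ → Ren (rescope L k) (rescope L k′)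
rescopeRen hole σ = σ
rescopeRen (ext L u) σ = rescopeRen L (liftR σ)

ren-plugL : (ρ : Ren n k) (L : SCtx n m) (t : Tm m) →
            ren ρ (plugL L t) ≡ plugL (renL ρ L) (ren (renHole ρ L) t)
ren-plugL ρ hole t = refl
ren-plugL ρ (ext L u) t = cong (λ x → es x (ren ρ u)) (ren-plugL (liftR ρ) L t)

wkL-renL : (ρ : Ren n k) (L : SCtx n m) → wkL (renL ρ L) ∘ ρ ≗ renHole ρ L ∘ wkL L
wkL-renL ρ hole i = refl
wkL-renL ρ (ext L u) i = wkL-renL (liftR ρ) L (suc i)

ren-plugL-renL : {σ : Ren k k′} {ρ : Ren n k} {τ : Ren n k′} → σ ∘ ρ ≗ τ →
                 (L : SCtx n m) (t : Tm (rescope L k)) →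
                 ren σ (plugL (renL ρ L) t) ≡ plugL (renL τ L) (ren (rescopeRen L σ) t)
ren-plugL-renL h hole t = refl
ren-plugL-renL h (ext L u) t = cong₂ es (ren-plugL-renL (liftR-∘ h) L t) (ren-∘ h u)

rescopeRen-renHole : {σ : Ren k k′} {ρ : Ren n k} {τ : Ren n k′} → σ ∘ ρ ≗ τ →
                     (L : SCtx n m) → rescopeRen L σ ∘ renHole ρ L ≗ renHole τ L
rescopeRen-renHole h hole = h
rescopeRen-renHole h (ext L u) = rescopeRen-renHole (liftR-∘ h) L

rescopeRen-wkL : {σ : Ren k k′} {ρ : Ren n k} {τ : Ren n k′} → σ ∘ ρ ≗ τ →
                 (L : SCtx n m) → rescopeRen L σ ∘ wkL (renL ρ L) ≗ wkL (renL τ L) ∘ σ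
rescopeRen-wkL h hole j = refl
rescopeRen-wkL h (ext L u) j = rescopeRen-wkL (liftR-∘ h) L (suc j)

plugSubst : (L : SCtx n m) → Tm (suc n) → Tm m → Tm n
plugSubst L t v = plugL L (ren (liftR (wkL L)) t [0≔ v ])

ren-plugSubst : (ρ : Ren n k) (L : SCtx n m) (t : Tm (suc n)) (v : Tm m) →
                ren ρ (plugSubst L t v) ≡
                plugSubst (renL ρ L) (ren (liftR ρ) t) (ren (renHole ρ L) v)
ren-plugSubst ρ L t v = trans (ren-plugL ρ L _) (cong (plugL (renL ρ L)) (begin
    ren ρ′ (sub (single v) (ren (liftR (wkL L)) t))            ≡⟨ ren-sub (λ _ → refl) (ren (liftR (wkL L)) t) ⟩
    sub (ren ρ′ ∘ single v) (ren (liftR (wkL L)) t)             ≡⟨ sub-ren (λ _ → refl) t ⟩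
    sub (ren ρ′ ∘ single v ∘ liftR (wkL L)) t                  ≡⟨ sub-ren pw t ⟨
    sub (single (ren ρ′ v)) (ren (liftR (wkL L′) ∘ liftR ρ) t)  ≡⟨ cong (sub _) (ren-∘ (λ _ → refl) t) ⟨
    sub (single (ren ρ′ v)) (ren (liftR (wkL L′)) (ren (liftR ρ) t)) ∎))
  where
  open ≡-Reasoning
  ρ′ = renHole ρ L
  L′ = renL ρ L
  pw : single (ren ρ′ v) ∘ (liftR (wkL L′) ∘ liftR ρ) ≗ ren ρ′ ∘ single v ∘ liftR (wkL L)
  pw zero = refl
  pw (suc i) = cong var (wkL-renL ρ L i)

StableUnderRenaming : Rel → Set
StableUnderRenaming R = ∀ {n m} (ρ : Ren n m) {a b : Tm n} → R a b → Ctx R (ren ρ a) (ren ρ b)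

ctx-ren : StableUnderRenaming R → (ρ : Ren n m) → Ctx R t u → Ctx R (ren ρ t) (ren ρ u)
ctx-ren h ρ (root r) = h ρ r
ctx-ren h ρ (appR t s) = appR (ren ρ t) (ctx-ren h ρ s)
ctx-ren h ρ (appL u s) = appL (ren ρ u) (ctx-ren h ρ s)
ctx-ren h ρ (esL u s) = esL (ren ρ u) (ctx-ren h (liftR ρ) s)
ctx-ren h ρ (esR t s) = esR (ren (liftR ρ) t) (ctx-ren h ρ s)

plugL-ctx : (L : SCtx n m) {a b : Tm m} → Ctx R a b → Ctx R (plugL L a) (plugL L b)
plugL-ctx hole s = s
plugL-ctx (ext L u) s = esL u (plugL-ctx L s)

rootM-ren : StableUnderRenaming RootM
rootM-ren ρ (rm L t u) =
  subst₂ _→m_ (cong (λ x → app x (ren ρ u)) (sym (ren-plugL ρ L (lam t))))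
              (trans (cong (λ x → plugL (renL ρ L) (es t′ x)) (ren-comm (wkL-renL ρ L) u))
                     (sym (ren-plugL ρ L _)))
              (root (rm (renL ρ L) t′ (ren ρ u)))
  where
  t′ = ren (liftR (renHole ρ L)) t

rootEλ-ren : StableUnderRenaming RootEλ
rootEλ-ren ρ (reλ t L u) =
  subst₂ _→eλ_ (cong (es (ren (liftR ρ) t)) (sym (ren-plugL ρ L (lam u))))
               (sym (ren-plugSubst ρ L t (lam u)))
               (root (reλ (ren (liftR ρ) t) (renL ρ L) (ren (liftR (renHole ρ L)) u)))

rootEvar-ren : StableUnderRenaming RootEvar
rootEvar-ren ρ (revar t L y) =
  subst₂ _→evar_ (cong (es (ren (liftR ρ) t)) (sym (ren-plugL ρ L (var y))))
                 (sym (ren-plugSubst ρ L t (var y)))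
                 (root (revar (ren (liftR ρ) t) (renL ρ L) (renHole ρ L y)))

swap01-liftR² : (ρ : Ren n m) → swap01 ∘ liftR (liftR ρ) ≗ liftR (liftR ρ) ∘ swap01
swap01-liftR² ρ zero = refl
swap01-liftR² ρ (suc zero) = refl
swap01-liftR² ρ (suc (suc i)) = refl

liftR-suc-liftR : (ρ : Ren n m) → liftR suc ∘ liftR ρ ≗ liftR (liftR ρ) ∘ liftR suc
liftR-suc-liftR ρ zero = refl
liftR-suc-liftR ρ (suc i) = refl

ren-≡s : (ρ : Ren n m) → t ≡s u → ren ρ t ≡s ren ρ u
ren-≡s ρ ≡refl = ≡refl
ren-≡s ρ (≡sym p) = ≡sym (ren-≡s ρ p)
ren-≡s ρ (≡trans p q) = ≡trans (ren-≡s ρ p) (ren-≡s ρ q)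
ren-≡s ρ (≡appR t p) = ≡appR (ren ρ t) (ren-≡s ρ p)
ren-≡s ρ (≡appL u p) = ≡appL (ren ρ u) (ren-≡s ρ p)
ren-≡s ρ (≡esL u p) = ≡esL (ren ρ u) (ren-≡s (liftR ρ) p)
ren-≡s ρ (≡esR t p) = ≡esR (ren (liftR ρ) t) (ren-≡s ρ p)
ren-≡s ρ (≡com t s u) =
  subst₂ _≡s_ (cong (λ x → es (es (ren (liftR (liftR ρ)) t) x) (ren ρ u)) (wk-ren ρ s))
              (cong₂ (λ a b → es (es a b) (ren ρ s)) (ren-comm (swap01-liftR² ρ) t) (wk-ren ρ u))
              (≡com (ren (liftR (liftR ρ)) t) (ren ρ s) (ren ρ u))
ren-≡s ρ (≡dup t s u) =
  subst (λ x → ren ρ (app t (es s u)) ≡s es (app x (ren (liftR ρ) s)) (ren ρ u)) (wk-ren ρ t)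
        (≡dup (ren ρ t) (ren (liftR ρ) s) (ren ρ u))
ren-≡s ρ (≡appES t u s) =
  subst (λ x → ren ρ (app (es t u) s) ≡s es (app (ren (liftR ρ) t) x) (ren ρ u)) (wk-ren ρ s)
        (≡appES (ren (liftR ρ) t) (ren ρ u) (ren ρ s))
ren-≡s ρ (≡esES t u s) =
  subst (λ x → ren ρ (es t (es u s)) ≡s es (es x (ren (liftR ρ) u)) (ren ρ s)) (ren-comm (liftR-suc-liftR ρ) t)
        (≡esES (ren (liftR ρ) t) (ren (liftR ρ) u) (ren ρ s))

-- Commuting an explicit substitution into a substitution context

≡s-setoid : ℕ → Setoid _ _
≡s-setoid n = record
  { Carrier = Tm n
  ; _≈_ = _≡s_
  ; isEquivalence = record { refl = ≡refl ; sym = ≡sym ; trans = ≡trans }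
  }

-- sends variable 0 of the hole of L to the fresh outermost variable of renL suc L
outerRen : (L : SCtx n m) → Ren (suc m) (rescope L (suc n))
outerRen L = wkL (renL suc L) zero ∷ renHole suc L

es-into-plugL : (L : SCtx n m) (Z : Tm (suc m)) (U : Tm n) →
                es (plugL (renL suc L) (ren (outerRen L) Z)) U ≡s plugL L (es Z (ren (wkL L) U))
es-into-plugL hole Z U =
  subst₂ (λ a b → es a U ≡s es Z b) (sym (ren-id zero∷suc Z)) (sym (ren-id (λ _ → refl) U)) ≡refl
  where
  zero∷suc : (zero ∷ suc) ≗ id {A = Fin (suc _)}
  zero∷suc zero = refl
  zero∷suc (suc i) = refl
es-into-plugL (ext L u) Z U = begin
  es (es X (wk u)) U                                      ≈⟨ ≡com X u U ⟩
  es (es (ren swap01 X) (wk U)) u                         ≡⟨ cong (λ x → es (es x (wk U)) u) swapped ⟩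
  es (es (plugL (renL suc L) (ren (outerRen L) Z)) (wk U)) u  ≈⟨ ≡esL u (es-into-plugL L Z (wk U)) ⟩
  es (plugL L (es Z (ren (wkL L) (wk U)))) u              ≡⟨ cong (λ x → es (plugL L (es Z x)) u) (ren-∘ (λ _ → refl) U) ⟩
  plugL (ext L u) (es Z (ren (wkL (ext L u)) U))          ∎
  where
  open SetoidReasoning (≡s-setoid _)
  X = plugL (renL (liftR suc) L) (ren (outerRen (ext L u)) Z)
  pw : rescopeRen L swap01 ∘ outerRen (ext L u) ≗ outerRen L
  pw zero = rescopeRen-wkL swap01-liftR-suc L (suc zero)
  pw (suc i) = rescopeRen-renHole swap01-liftR-suc L i
  swapped : ren swap01 X ≡ plugL (renL suc L) (ren (outerRen L) Z)
  swapped = trans (ren-plugL-renL swap01-liftR-suc L _) (cong (plugL (renL suc L)) (ren-∘ pw Z))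

tr-ren : (ρ : Ren n m) → tr ∘ ren ρ ≗ ren ρ ∘ tr
tr-ren ρ (var i) = refl
tr-ren ρ (lam t) = cong lam (tr-ren (liftR ρ) t)
tr-ren ρ (app t u) =
  cong₂ es (cong (λ x → app x (var zero)) (trans (cong wk (tr-ren ρ t)) (wk-ren ρ (tr t))))
           (tr-ren ρ u)
tr-ren ρ (es t u) = cong₂ es (tr-ren (liftR ρ) t) (tr-ren ρ u)

tr-liftS : {σ τ : Sub n m} → tr ∘ σ ≗ τ → tr ∘ liftS σ ≗ liftS τ
tr-liftS h zero = refl
tr-liftS {σ = σ} h (suc i) = trans (tr-ren suc (σ i)) (cong wk (h i))

tr-sub : {σ τ : Sub n m} → tr ∘ σ ≗ τ → tr ∘ sub σ ≗ sub τ ∘ tr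
tr-sub h (var i) = h i
tr-sub h (lam t) = cong lam (tr-sub (tr-liftS h) t)
tr-sub {τ = τ} h (app t u) =
  cong₂ es (cong (λ x → app x (var zero)) (trans (cong wk (tr-sub h t)) (wk-sub τ (tr t))))
           (tr-sub h u)
tr-sub h (es t u) = cong₂ es (tr-sub (tr-liftS h) t) (tr-sub h u)

trL : SCtx n m → SCtx n m
trL hole = hole
trL (ext L u) = ext (trL L) (tr u)

tr-plugL : (L : SCtx n m) (t : Tm m) → tr (plugL L t) ≡ plugL (trL L) (tr t)
tr-plugL hole t = refl
tr-plugL (ext L u) t = cong (λ x → es x (tr u)) (tr-plugL L t)

wkL-trL : (L : SCtx n m) → wkL (trL L) ≗ wkL L
wkL-trL hole i = refl
wkL-trL (ext L u) i = wkL-trL L (suc i)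

tr-plugSubst : (L : SCtx n m) (t : Tm (suc n)) (v : Tm m) →
               tr (plugSubst L t v) ≡ plugSubst (trL L) (tr t) (tr v)
tr-plugSubst L t v = trans (tr-plugL L _) (cong (plugL (trL L)) (begin
    tr (sub (single v) (ren (liftR (wkL L)) t))       ≡⟨ tr-sub tr-single (ren (liftR (wkL L)) t) ⟩
    sub (single (tr v)) (tr (ren (liftR (wkL L)) t))  ≡⟨ cong (sub _) (tr-ren _ t) ⟩
    sub (single (tr v)) (ren (liftR (wkL L)) (tr t))  ≡⟨ sub-ren pw (tr t) ⟩
    sub (single (tr v) ∘ liftR (wkL (trL L))) (tr t)  ≡⟨ sub-ren (λ _ → refl) (tr t) ⟨
    sub (single (tr v)) (ren (liftR (wkL (trL L))) (tr t)) ∎))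
  where
  open ≡-Reasoning
  tr-single : tr ∘ single v ≗ single (tr v)
  tr-single zero = refl
  tr-single (suc i) = refl
  pw : single (tr v) ∘ liftR (wkL L) ≗ single (tr v) ∘ liftR (wkL (trL L))
  pw zero = refl
  pw (suc i) = cong var (sym (wkL-trL L i))

tr-ctx : StableUnderRenaming R → (∀ {n} {a b : Tm n} → R a b → Ctx R (tr a) (tr b)) →
         Ctx R t u → Ctx R (tr t) (tr u)
tr-ctx h g (root r) = g r
tr-ctx h g (appR t s) = esR _ (tr-ctx h g s)
tr-ctx h g (appL u s) = esL (tr u) (appL (var zero) (ctx-ren h suc (tr-ctx h g s)))
tr-ctx h g (esL u s) = esL (tr u) (tr-ctx h g s)
tr-ctx h g (esR t s) = esR (tr t) (tr-ctx h g s)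

tr-rootEλ : {a b : Tm n} → RootEλ a b → tr a →eλ tr b
tr-rootEλ (reλ t L u) =
  subst₂ _→eλ_ (cong (es (tr t)) (sym (tr-plugL L (lam u)))) (sym (tr-plugSubst L t (lam u)))
               (root (reλ (tr t) (trL L) (tr u)))

tr-rootEvar : {a b : Tm n} → RootEvar a b → tr a →evar tr b
tr-rootEvar (revar t L y) =
  subst₂ _→evar_ (cong (es (tr t)) (sym (tr-plugL L (var y)))) (sym (tr-plugSubst L t (var y)))
                 (root (revar (tr t) (trL L) y))

_→m→evar≡s_ : Rel
t →m→evar≡s u = Σ _ λ r₁ → Σ _ λ r → (t →m r₁) × (r₁ →evar r) × (r ≡s u)

map-→m→evar≡s : {f : Tm n → Tm m} →
                (∀ {a b} → a →m b → f a →m f b) → (∀ {a b} → a →evar b → f a →evar f b) →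
                (∀ {a b} → a ≡s b → f a ≡s f b) → t →m→evar≡s u → f t →m→evar≡s f u
map-→m→evar≡s {f = f} fm fe fs (r₁ , r , s₁ , s₂ , p) = f r₁ , f r , fm s₁ , fe s₂ , fs p

tr-rootM : {a b : Tm n} → RootM a b → tr a →m→evar≡s tr b
tr-rootM (rm L t u) =
  es (plugL L″ (es T′ (var y))) U ,
  es (plugL L″ (plugSubst hole T′ (var y))) U ,
  subst (λ x → es (app x (var zero)) U →m es (plugL L″ (es T′ (var y))) U) (sym wk-redex) (esL U (root (rm L″ T′ (var zero)))) ,
  esL U (plugL-ctx L″ (root (revar T′ hole y))) ,
  (begin
    es (plugL L″ (plugSubst hole T′ (var y))) U  ≡⟨ cong (λ x → es (plugL L″ x) U) contracted ⟩
    es (plugL L″ (ren (outerRen L′) T)) U        ≈⟨ es-into-plugL L′ T U ⟩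
    plugL L′ (es T (ren (wkL L′) U))            ≡⟨ cong (λ x → plugL L′ (es T x)) tr-arg ⟨
    plugL L′ (tr (es t (ren (wkL L) u)))        ≡⟨ tr-plugL L _ ⟨
    tr (plugL L (es t (ren (wkL L) u)))         ∎)
  where
  open SetoidReasoning (≡s-setoid _)
  L′ = trL L
  T = tr t
  U = tr u
  L″ = renL suc L′
  T′ = ren (liftR (renHole suc L′)) T
  y = wkL L″ zero
  wk-redex : wk (tr (plugL L (lam t))) ≡ plugL L″ (lam T′)
  wk-redex = trans (cong wk (tr-plugL L (lam t))) (ren-plugL suc L′ (lam T))
  contracted : plugSubst hole T′ (var y) ≡ ren (outerRen L′) T
  contracted = trans (cong _[0≔ var y ] (ren-∘ (liftR-∘ (λ _ → refl)) T))
                     ([0≔var]-ren (renHole suc L′) y T)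
  tr-arg : tr (ren (wkL L) u) ≡ ren (wkL L′) U
  tr-arg = trans (tr-ren (wkL L) u) (ren-ext (sym ∘ wkL-trL L) U)

tr-→m : t →m u → tr t →m→evar≡s tr u
tr-→m (root r) = tr-rootM r
tr-→m (appR t s) = map-→m→evar≡s (esR _) (esR _) (≡esR _) (tr-→m s)
tr-→m (appL u s) =
  map-→m→evar≡s (esL (tr u) ∘ appL (var zero) ∘ ctx-ren rootM-ren suc)
                (esL (tr u) ∘ appL (var zero) ∘ ctx-ren rootEvar-ren suc)
                (≡esL (tr u) ∘ ≡appL (var zero) ∘ ren-≡s suc)
                (tr-→m s)
tr-→m (esL u s) = map-→m→evar≡s (esL _) (esL _) (≡esL _) (tr-→m s)
tr-→m (esR t s) = map-→m→evar≡s (esR _) (esR _) (≡esR _) (tr-→m s)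

tr-≡s : t ≡s u → tr t ≡s tr u
tr-≡s ≡refl = ≡refl
tr-≡s (≡sym p) = ≡sym (tr-≡s p)
tr-≡s (≡trans p q) = ≡trans (tr-≡s p) (tr-≡s q)
tr-≡s (≡appR t p) = ≡esR _ (tr-≡s p)
tr-≡s (≡appL u p) = ≡esL (tr u) (≡appL (var zero) (ren-≡s suc (tr-≡s p)))
tr-≡s (≡esL u p) = ≡esL (tr u) (tr-≡s p)
tr-≡s (≡esR t p) = ≡esR (tr t) (tr-≡s p)
tr-≡s (≡com t s u) =
  subst₂ _≡s_ (cong (λ x → es (es (tr t) x) (tr u)) (sym (tr-ren suc s)))
              (sym (cong₂ (λ a b → es (es a b) (tr s)) (tr-ren swap01 t) (tr-ren suc u)))
              (≡com (tr t) (tr s) (tr u))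
tr-≡s (≡dup t s u) =
  subst (λ x → tr (app t (es s u)) ≡s es (es (app x (var zero)) (tr s)) (tr u))
        (trans (sym (wk-ren suc (tr t))) (cong wk (sym (tr-ren suc t))))
        (≡esES (app (wk (tr t)) (var zero)) (tr s) (tr u))
tr-≡s (≡appES t u s) =
  ≡trans (≡esL (tr s) (≡appES (ren (liftR suc) (tr t)) (wk (tr u)) (var zero)))
         (subst₂ (λ a b → es (es (app (ren (liftR suc) (tr t)) (var (suc zero))) (wk (tr u))) (tr s)
                          ≡s es (es (app a (var zero)) b) (tr u))
                 (ren-∘ swap01-liftR-suc (tr t)) (sym (tr-ren suc s))
                 (≡com (app (ren (liftR suc) (tr t)) (var (suc zero))) (tr u) (tr s)))
tr-≡s (≡esES t u s) =
  subst (λ x → tr (es t (es u s)) ≡s es (es x (tr u)) (tr s)) (sym (tr-ren (liftR suc) t))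
        (≡esES (tr t) (tr u) (tr s))

lemma8 : (∀ {n : ℕ} {t u : Tm n} → t →m u →
    Σ (Tm n) λ r₁ → Σ (Tm n) λ r → (tr t →m r₁) × (r₁ →evar r) × (r ≡s tr u))
    × (∀ {n : ℕ} {t u : Tm n} → t →eλ u → tr t →eλ tr u)
    × (∀ {n : ℕ} {t u : Tm n} → t →evar u → tr t →evar tr u)
    × (∀ {n : ℕ} {t u : Tm n} → t ≡s u → tr t ≡s tr u)
lemma8 = tr-→m , tr-ctx rootEλ-ren tr-rootEλ , tr-ctx rootEvar-ren tr-rootEvar , tr-≡s
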